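{- Let $r,s$ be positive integers and let $f,g\in\mathcal{B}_{r,s}$. Then (1) $f\otimes g\in\mathcal{B}_{r,s}$; and (2) for every positive divisor $d$ of $r$, $\alpha_{f\otimes g}(d)=r^s\,\alpha_f(d)\,\alpha_g(d)$.
   Context: For a positive integer $s$ and integers $a,b$ not both zero, $(a,b)_s$ denotes the largest $l^s$ ($l\in\mathbb{N}$) dividing both $a$ and $b$. An arithmetic function $f$ is $(r,s)$-even if $f(n)=f((n,r^s)_s)$ for all $n\in\mathbb{N}$; $\mathcal{B}_{r,s}$ denotes the set of all $(r,s)$-even functions. Such functions are periodic mod $r^s$ and are regarded as functions on $\mathbb{Z}$ by periodicity. For $r^s$-periodic $f,g$, the Cauchy convolution is $(f\otimes g)(n)=\sum_{k=1}^{r^s} f(k)\,g(n-k)$. The generalized Ramanujan sum is $c_{r,s}(n)=\sum_{1\le j\le r^s,\ (j,r^s)_s=1}\exp\left(\frac{2\pi i n j}{r^s}\right)$. For $f\in\mathcal{B}_{r,s}$ and $d\mid r$, $\alpha_f(d)=\frac{1}{r^s}\sum_{e\mid r} f(e^s)\,c_{\frac{r}{e},s}\!\left(\left(\frac{r}{d}\right)^s\right)$ (these are the unique coefficients with $f(n)=\sum_{d\mid r}\alpha_f(d)c_{d,s}(n)$). -}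

module Defs where

open import Level using (Level)
open import Data.Nat as ℕ using (ℕ; zero; suc; _∸_; NonZero; _≡ᵇ_)
open import Data.Nat.Divisibility using (_∣_; _∣?_)
open import Data.Nat.DivMod using (_/_; _%_)
open import Data.Bool using (Bool; true; false; if_then_else_; _∧_)
open import Relation.Nullary.Decidable using (⌊_⌋)
open import Algebra.Bundles using (CommutativeRing; Semiring)

-- (a , b)_s : the largest l^s (l ∈ ℕ, l ≥ 1) dividing both a and b.
-- Computed by searching l = b, b-1, ..., 1 (for s ≥ 1 and b ≥ 1 any
-- l with l^s ∣ b satisfies l ≤ b, and l = 1 always qualifies).

gcdPowSearch : ℕ → ℕ → ℕ → ℕ → ℕ
gcdPowSearch s a b zero    = 1
gcdPowSearch s a b (suc l) =
  if ⌊ (suc l) ℕ.^ s ∣? a ⌋ ∧ ⌊ (suc l) ℕ.^ s ∣? b ⌋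
  then (suc l) ℕ.^ s
  else gcdPowSearch s a b l

gcdPow : (s a b : ℕ) → ℕ
gcdPow s a b = gcdPowSearch s a b b

-- Everything below lives over a commutative ring K (playing the role of ℂ)
-- with a chosen element ζ (playing the role of exp(2πi / r^s)).

module Setup {c ℓ : Level} (K : CommutativeRing c ℓ) where
  open CommutativeRing K
  open import Algebra.Definitions.RawSemiring (Semiring.rawSemiring semiring) using (_^_; _×_)

  -- arithmetic functions with values in K (value at 0 is irrelevant)
  ArithFun : Set c
  ArithFun = ℕ → Carrier

  sum1 : ℕ → (ℕ → Carrier) → Carrier
  sum1 zero    h = 0#
  sum1 (suc n) h = sum1 n h + h (suc n)

  IsEven : (r s : ℕ) → ArithFun → Set ℓ
  IsEven r s f = ∀ n → NonZero n → f n ≈ f (gcdPow s n (r ℕ.^ s))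

  rep : (N : ℕ) → .{{NonZero N}} → ℕ → ℕ
  rep N m with m % N
  ... | zero  = N
  ... | suc t = suc t

  -- Cauchy convolution of N-periodic functions, N = r^s:
  -- (f ⊗ g)(n) = Σ_{k=1}^{N} f(k) g(n - k), where g(n-k) is read via
  -- periodicity as g(rep N (n + N - k)) (note n + N ∸ k ≡ n - k mod N
  -- since 1 ≤ k ≤ N, and no truncation happens).
  conv : (N : ℕ) → .{{NonZero N}} → ArithFun → ArithFun → ArithFun
  conv N f g n = sum1 N (λ k → f k * g (rep N ((n ℕ.+ N) ∸ k)))

  -- Generalized Ramanujan sum c_{m,s}(n), for m ∣ r with cofactor e
  -- (m * e = r), using ζ^{e^s} as exp(2πi / m^s) when ζ plays exp(2πi / r^s):
  -- c_{m,s}(n) = Σ_{1 ≤ j ≤ m^s, (j, m^s)_s = 1} (ζ^{e^s})^{n j}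
  ramanujan : (ζ : Carrier) (s m e n : ℕ) → Carrier
  ramanujan ζ s m e n =
    sum1 (m ℕ.^ s) (λ j →
      if gcdPow s j (m ℕ.^ s) ≡ᵇ 1
      then ζ ^ ((n ℕ.* j) ℕ.* (e ℕ.^ s))
      else 0#)

  -- α_f(d) = (1/r^s) Σ_{e ∣ r} f(e^s) c_{r/e,s}((r/d)^s),
  -- where invN is the inverse of r^s in K.
  alpha : (ζ invN : Carrier) (r s : ℕ) → ArithFun → (d : ℕ) → .{{NonZero d}} → Carrier
  alpha ζ invN r s f d =
    invN * sum1 r (λ e →
      if ⌊ e ∣? r ⌋
      then f (e ℕ.^ s) * ramanujan ζ s (r / suc (e ∸ 1)) e ((r / d) ℕ.^ s)
      else 0#)

  pow : Carrier → ℕ → Carrier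
  pow x n = x ^ n

  natK : ℕ → Carrier
  natK n = n × 1#

{-# OPTIONS --safe #-}
-- Write N = r ^ s and G k = (k, N)_s.  A function is (r,s)-even iff it is constant on each
-- class {k : G k = e ^ s}, e ∣ r.  For an N-th root of unity ω of order N put
-- F_ω h m = Σ_{k ≤ N} h k ω ^ (k m).  Grouping k by classes writes F_ω h as a combination of the
-- sums R_e m = Σ_{G k = e ^ s} ω ^ (k m).  Adding up R_e′ over the multiples e′ of e dividing r
-- gives Σ_{e ^ s ∣ k} ω ^ (k m), a geometric sum that depends only on G m; so by downward
-- induction on e every R_e, and hence F_ω h for even h, depends only on G m.  F_ζ turns ⊗ into
-- the pointwise product and F_{ζ ^ (N - 1)} inverts it up to the factor N, so f ⊗ g is constant
-- on classes, i.e. (r,s)-even.  Finally c_{r/e,s} is R_e after substituting k = j e ^ s, whence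
-- α_h d = N⁻¹ F_ζ h ((r/d) ^ s) for even h, and (2) reads N⁻¹ F f F g = N (N⁻¹ F f) (N⁻¹ F g).
module Submission where

open import Defs
open import Data.Nat.Base using (ℕ; NonZero)
open import Algebra.Bundles using (CommutativeRing; Semiring)

module Arithmetic where

  open import Data.Nat.Base
  open import Data.Nat.Properties
  open import Data.Nat.Divisibility
  open import Data.Nat.DivMod using (_/_; m/n*n≡m)
  open import Data.Nat.GCD using (gcd; gcd[m,n]∣m; gcd[m,n]∣n; gcd[m,n]≢0)
  open import Data.Nat.LCM using (lcm; m∣lcm[m,n]; n∣lcm[m,n]; gcd*lcm)
  open import Data.Nat.Coprimality as Coprimality using (Coprime; coprime-divisor; coprime-/gcd)
  open import Relation.Binary.PropositionalEquality
  open import Relation.Nullary using (yes; no; contradiction)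
  open import Relation.Binary.Definitions using (tri<; tri≈; tri>)
  open import Data.Product using (_,_)
  open import Data.Sum using (inj₁)
  open import Data.Nat.Solver using (module +-*-Solver)
  open +-*-Solver

  ^-distribʳ-* : ∀ m n o → (m * n) ^ o ≡ m ^ o * n ^ o
  ^-distribʳ-* m n zero    = refl
  ^-distribʳ-* m n (suc o) rewrite ^-distribʳ-* m n o =
    solve 4 (λ m n x y → m :* n :* (x :* y) := m :* x :* (n :* y)) refl m n (m ^ o) (n ^ o)

  ^-monoˡ-∣ : ∀ {m n} o → m ∣ n → m ^ o ∣ n ^ o
  ^-monoˡ-∣ zero    m∣n = ∣-refl
  ^-monoˡ-∣ (suc o) m∣n = *-pres-∣ m∣n (^-monoˡ-∣ o m∣n)

  ^-injectiveˡ : ∀ {m n} o .{{_ : NonZero o}} → m ^ o ≡ n ^ o → m ≡ n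
  ^-injectiveˡ {m} {n} o eq with <-cmp m n
  ... | tri< m<n _ _ = contradiction eq (<⇒≢ (^-monoˡ-< o m<n))
  ... | tri≈ _ m≡n _ = m≡n
  ... | tri> _ _ n<m = contradiction (sym eq) (<⇒≢ (^-monoˡ-< o n<m))

  0^n≡0 : ∀ n .{{_ : NonZero n}} → 0 ^ n ≡ 0
  0^n≡0 (suc n) = refl

  m≤m^n : ∀ m n .{{_ : NonZero n}} → m ≤ m ^ n
  m≤m^n zero    n       = z≤n
  m≤m^n (suc m) (suc n) = m≤m*n (suc m) (suc m ^ n) {{m^n≢0 (suc m) n}}

  m^n∣o⇒m≢0 : ∀ {m o} n .{{_ : NonZero n}} .{{_ : NonZero o}} → m ^ n ∣ o → NonZero m
  m^n∣o⇒m≢0 {zero} n 0^n∣o = contradiction (0∣⇒≡0 (subst (_∣ _) (0^n≡0 n) 0^n∣o)) (≢-nonZero⁻¹ _)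
  m^n∣o⇒m≢0 {suc m} n _   = _

  coprime-*ʳ : ∀ {m n o} → Coprime m n → Coprime m o → Coprime m (n * o)
  coprime-*ʳ cop[m,n] cop[m,o] (d∣m , d∣no) =
    cop[m,o] (d∣m , coprime-divisor (λ (e∣d , e∣n) → cop[m,n] (∣-trans e∣d d∣m , e∣n)) d∣no)

  coprime-^ʳ : ∀ {m n} → Coprime m n → ∀ o → Coprime m (n ^ o)
  coprime-^ʳ cop zero    (_ , d∣1) = ∣1⇒≡1 d∣1
  coprime-^ʳ cop (suc o) = coprime-*ʳ cop (coprime-^ʳ cop o)

  coprime-^ : ∀ {m n} → Coprime m n → ∀ o p → Coprime (m ^ o) (n ^ p)
  coprime-^ cop o p = Coprimality.sym (coprime-^ʳ (Coprimality.sym (coprime-^ʳ cop p)) o)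

  -- With g = gcd m n, m = m′ g and n = n′ g (m′, n′ coprime) we have lcm m n = m n′;
  -- coprimality of n′ ^ o and m′ ^ o turns n ^ o ∣ x into n′ ^ o ∣ x / m ^ o.
  lcm-^-∣ : ∀ o .{{_ : NonZero o}} m n {x} → m ^ o ∣ x → n ^ o ∣ x → lcm m n ^ o ∣ x
  lcm-^-∣ o zero        n m^o∣x _     = m^o∣x
  lcm-^-∣ o m@(suc _) n {x} m^o∣x n^o∣x =
    subst₂ _∣_ (sym (^-distribʳ-* m n′ o)) (sym x≡t*m^o)
      (subst (m ^ o * n′ ^ o ∣_) (*-comm (m ^ o) t) (*-monoʳ-∣ (m ^ o) n′^o∣t))
    where
      g  = gcd m n
      m′ = m / g
      n′ = n / g
      t  = quotient m^o∣x
      instance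
        _ = ≢-nonZero (gcd[m,n]≢0 m n (inj₁ λ ()))
        _ = m^n≢0 g o
      x≡t*m^o : x ≡ t * m ^ o
      x≡t*m^o = m∣n⇒n≡quotient*m m^o∣x
      /g-^ : ∀ {k} → g ∣ k → k ^ o ≡ (k / g) ^ o * g ^ o
      /g-^ g∣k = trans (cong (_^ o) (sym (m/n*n≡m g∣k))) (^-distribʳ-* _ g o)
      x≡m′^o*t*g^o : x ≡ m′ ^ o * t * g ^ o
      x≡m′^o*t*g^o = begin
        x                       ≡⟨ x≡t*m^o ⟩
        t * m ^ o               ≡⟨ cong (t *_) (/g-^ (gcd[m,n]∣m m n)) ⟩
        t * (m′ ^ o * g ^ o)    ≡⟨ solve 3 (λ t a b → t :* (a :* b) := a :* t :* b) refl t (m′ ^ o) (g ^ o) ⟩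
        m′ ^ o * t * g ^ o      ∎
        where open ≡-Reasoning
      n′^o∣t : n′ ^ o ∣ t
      n′^o∣t = coprime-divisor (coprime-^ (Coprimality.sym (coprime-/gcd m n)) o o)
        (*-cancelʳ-∣ (g ^ o) (subst₂ _∣_ (/g-^ (gcd[m,n]∣n m n)) x≡m′^o*t*g^o n^o∣x))

  lcm≤n⇒m∣n : ∀ {m n} .{{_ : NonZero m}} .{{_ : NonZero n}} → lcm m n ≤ n → m ∣ n
  lcm≤n⇒m∣n {m} {n} lcm≤n = subst (m ∣_) lcm≡n (m∣lcm[m,n] m n)
    where
      instance
        _ : NonZero (lcm m n)
        _ = m*n≢0⇒n≢0 (gcd m n) {{subst NonZero (sym (gcd*lcm m n)) (m*n≢0 m n)}}
      lcm≡n : lcm m n ≡ n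
      lcm≡n = ≤-antisym lcm≤n (∣⇒≤ (n∣lcm[m,n] m n))

  ^-cancelˡ-∣ : ∀ {m n} o .{{_ : NonZero o}} .{{_ : NonZero n}} → m ^ o ∣ n ^ o → m ∣ n
  ^-cancelˡ-∣ {m} {n} o m^o∣n^o =
    lcm≤n⇒m∣n (≮⇒≥ λ n<lcm → <⇒≱ (^-monoˡ-< o n<lcm) (∣⇒≤ (lcm-^-∣ o m n m^o∣n^o ∣-refl)))
    where instance
      _ = m^n≢0 n o
      _ = m^n∣o⇒m≢0 o m^o∣n^o

  ∣-+-range⇒≤ : ∀ {N k n x} → 0 < n → k ≤ N → N ∣ k + x → N ∣ n + x → k ≤ n
  ∣-+-range⇒≤ {N} {k} {n} {x} 0<n k≤N N∣k+x N∣n+x with k ≤? n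
  ... | yes k≤n = k≤n
  ... | no  k≰n = contradiction N∣k∸n (>⇒∤ {{>-nonZero (m<n⇒0<n∸m n<k)}} k∸n<N)
    where
      n<k = ≰⇒> k≰n
      k∸n<N : k ∸ n < N
      k∸n<N = <-≤-trans (∸-monoʳ-< 0<n (<⇒≤ n<k)) k≤N
      k+x≡n+x+d : k + x ≡ n + x + (k ∸ n)
      k+x≡n+x+d = trans (cong (_+ x) (sym (m+[n∸m]≡n (<⇒≤ n<k))))
                       (solve 3 (λ n d x → n :+ d :+ x := n :+ x :+ d) refl n (k ∸ n) x)
      N∣k∸n : N ∣ k ∸ n
      N∣k∸n = ∣m+n∣m⇒∣n (subst (N ∣_) k+x≡n+x+d N∣k+x) N∣n+x

  ∣-+-range⇒≡ : ∀ {N k n x} → 0 < k → k ≤ N → 0 < n → n ≤ N → N ∣ k + x → N ∣ n + x → k ≡ n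
  ∣-+-range⇒≡ 0<k k≤N 0<n n≤N N∣k+x N∣n+x =
    ≤-antisym (∣-+-range⇒≤ 0<n k≤N N∣k+x N∣n+x) (∣-+-range⇒≤ 0<k n≤N N∣n+x N∣k+x)

module PowerGcd (s : ℕ) .{{_ : NonZero s}} where

  open import Data.Nat.Base
  open import Data.Nat.Properties
  open import Data.Nat.Divisibility
  open import Data.Nat.LCM using (lcm)
  open import Data.Product using (_×_; _,_; proj₁; proj₂)
  open import Data.Sum using (inj₁; inj₂)
  open import Function.Base using (_∘_)
  open import Relation.Binary.PropositionalEquality
  open import Relation.Nullary using (¬_; yes; no; contradiction)
  open Arithmetic

  CommonPowerDivisor : ℕ → ℕ → ℕ → Set
  CommonPowerDivisor a b l = l ^ s ∣ a × l ^ s ∣ b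

  record LargestUpTo (a b l v : ℕ) : Set where
    field
      base       : ℕ
      v≡base^s   : v ≡ base ^ s
      base>0     : 0 < base
      common     : CommonPowerDivisor a b base
      none-above : ∀ {k} → base < k → k ≤ l → ¬ CommonPowerDivisor a b k

  private
    skip : ∀ {a b l v} → ¬ CommonPowerDivisor a b (suc l) → LargestUpTo a b l v → LargestUpTo a b (suc l) v
    skip {a} {b} {l} ¬common[l+1] largest = record
      { LargestUpTo largest ; none-above = none-above′ }
      where
        open LargestUpTo largest
        none-above′ : ∀ {k} → base < k → k ≤ suc l → ¬ CommonPowerDivisor a b k
        none-above′ base<k k≤l+1 with m≤n⇒m<n∨m≡n k≤l+1
        ... | inj₁ k<l+1 = none-above base<k (s≤s⁻¹ k<l+1)
        ... | inj₂ refl  = ¬common[l+1]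

  gcdPowSearch-spec : ∀ a b l → LargestUpTo a b l (gcdPowSearch s a b l)
  gcdPowSearch-spec a b zero = record
    { base = 1 ; v≡base^s = sym (^-zeroˡ s) ; base>0 = z<s
    ; common = subst (_∣ a) (sym (^-zeroˡ s)) (1∣ a) , subst (_∣ b) (sym (^-zeroˡ s)) (1∣ b)
    ; none-above = λ { (s≤s (s≤s _)) () } }
  gcdPowSearch-spec a b (suc l) with suc l ^ s ∣? a | suc l ^ s ∣? b
  ... | yes p | yes q = record
    { base = suc l ; v≡base^s = refl ; base>0 = z<s ; common = p , q
    ; none-above = λ l<k k≤l → contradiction k≤l (<⇒≱ l<k) }
  ... | yes _ | no ¬q = skip (¬q ∘ proj₂) (gcdPowSearch-spec a b l)
  ... | no ¬p | _     = skip (¬p ∘ proj₁) (gcdPowSearch-spec a b l)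

  record IsGcdPow (a b v : ℕ) : Set where
    field
      base     : ℕ
      v≡base^s : v ≡ base ^ s
      base>0   : 0 < base
      common   : CommonPowerDivisor a b base
      greatest : ∀ {l} → CommonPowerDivisor a b l → l ∣ base

  lcm-common : ∀ {a b} l m → CommonPowerDivisor a b l → CommonPowerDivisor a b m →
               CommonPowerDivisor a b (lcm l m)
  lcm-common l m (l^s∣a , l^s∣b) (m^s∣a , m^s∣b) =
    lcm-^-∣ s l m l^s∣a m^s∣a , lcm-^-∣ s l m l^s∣b m^s∣b

  gcdPow-spec : ∀ a b .{{_ : NonZero b}} → IsGcdPow a b (gcdPow s a b)
  gcdPow-spec a b = record
    { base = base ; v≡base^s = v≡base^s ; base>0 = base>0 ; common = common ; greatest = greatest }
    where
      open LargestUpTo (gcdPowSearch-spec a b b)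
      instance _ = >-nonZero base>0
      greatest : ∀ {l} → CommonPowerDivisor a b l → l ∣ base
      greatest {l} common[l] = lcm≤n⇒m∣n {{m^n∣o⇒m≢0 s (proj₂ common[l])}} (≮⇒≥ λ base<lcm →
        none-above base<lcm (≤-trans (m≤m^n _ s) (∣⇒≤ (proj₂ common[lcm]))) common[lcm])
        where common[lcm] = lcm-common l base common[l] common

  gcdPowSearch-congˡ : ∀ {a a′} b l → (∀ {d} → d ∣ b → d ∣ a → d ∣ a′) →
                       (∀ {d} → d ∣ b → d ∣ a′ → d ∣ a) →
                       gcdPowSearch s a b l ≡ gcdPowSearch s a′ b l
  gcdPowSearch-congˡ b zero _ _ = refl
  gcdPowSearch-congˡ {a} {a′} b (suc l) a⇒a′ a′⇒a
    with suc l ^ s ∣? a | suc l ^ s ∣? a′ | suc l ^ s ∣? b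
  ... | yes _ | yes _  | yes _ = refl
  ... | yes p | no ¬p′ | yes q = contradiction (a⇒a′ q p) ¬p′
  ... | no ¬p | yes p′ | yes q = contradiction (a′⇒a q p′) ¬p
  ... | yes _ | yes _  | no _  = gcdPowSearch-congˡ b l a⇒a′ a′⇒a
  ... | yes _ | no _   | no _  = gcdPowSearch-congˡ b l a⇒a′ a′⇒a
  ... | no _  | yes _  | no _  = gcdPowSearch-congˡ b l a⇒a′ a′⇒a
  ... | no _  | no _   | _     = gcdPowSearch-congˡ b l a⇒a′ a′⇒a

  gcdPow-congˡ : ∀ {a a′} b → (∀ {d} → d ∣ b → d ∣ a → d ∣ a′) →
                 (∀ {d} → d ∣ b → d ∣ a′ → d ∣ a) →
                 gcdPow s a b ≡ gcdPow s a′ b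
  gcdPow-congˡ b = gcdPowSearch-congˡ b b

module Classes (s : ℕ) .{{_ : NonZero s}} (r : ℕ) .{{_ : NonZero r}} where

  open import Data.Nat.Base
  open import Data.Nat.Properties
  open import Data.Nat.Divisibility
  open import Data.Nat.DivMod using (_%_)
  open import Data.Product using (_,_; proj₁; proj₂)
  open import Function.Base using (it; _∘_)
  open import Function.Bundles using (_⇔_; mk⇔; Equivalence)
  open import Relation.Binary.PropositionalEquality
  open Arithmetic
  open PowerGcd s

  N : ℕ
  N = r ^ s

  instance
    N≢0 : NonZero N
    N≢0 = m^n≢0 r s

  G : ℕ → ℕ
  G k = gcdPow s k N

  module _ (k : ℕ) where
    open IsGcdPow (gcdPow-spec k N) public
      using (base; base>0) renaming (v≡base^s to G≡base^s)

  private
    instance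
      base≢0 : ∀ {k} → NonZero (base k)
      base≢0 {k} = >-nonZero (base>0 k)

  base^s∣ : ∀ k → base k ^ s ∣ k
  base^s∣ k = proj₁ (IsGcdPow.common (gcdPow-spec k N))

  base∣r : ∀ k → base k ∣ r
  base∣r k = ^-cancelˡ-∣ s (proj₂ (IsGcdPow.common (gcdPow-spec k N)))

  ∣base⇔^s∣ : ∀ {e} k → e ∣ r → e ∣ base k ⇔ e ^ s ∣ k
  ∣base⇔^s∣ {e} k e∣r = mk⇔
    (λ e∣base → ∣-trans (^-monoˡ-∣ s e∣base) (base^s∣ k))
    (λ e^s∣k → IsGcdPow.greatest (gcdPow-spec k N) (e^s∣k , ^-monoˡ-∣ s e∣r))

  G≡e^s⇒base≡e : ∀ {k e} → G k ≡ e ^ s → base k ≡ e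
  G≡e^s⇒base≡e {k} G≡e^s = ^-injectiveˡ s (trans (sym (G≡base^s k)) G≡e^s)

  G>0 : ∀ k → 0 < G k
  G>0 k = subst (0 <_) (sym (G≡base^s k)) (m^n>0 (base k) s)

  G∣ : ∀ k → G k ∣ k
  G∣ k = subst (_∣ k) (sym (G≡base^s k)) (base^s∣ k)

  G-idem : ∀ k → G (G k) ≡ G k
  G-idem k = begin
    G (G k)         ≡⟨ G≡base^s (G k) ⟩
    base (G k) ^ s  ≡⟨ cong (_^ s) base[Gk]≡base[k] ⟩
    base k ^ s      ≡⟨ G≡base^s k ⟨
    G k             ∎
    where
      open ≡-Reasoning
      base[Gk]≡base[k] : base (G k) ≡ base k
      base[Gk]≡base[k] = ∣-antisym
        (^-cancelˡ-∣ s (subst (base (G k) ^ s ∣_) (G≡base^s k) (base^s∣ (G k))))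
        (Equivalence.from (∣base⇔^s∣ (G k) (base∣r k)) (∣-reflexive (sym (G≡base^s k))))

  G-mod : ∀ k → G k ≡ G (k % N)
  G-mod k = gcdPow-congˡ N (λ d∣N d∣k → %-presˡ-∣ d∣k d∣N) (λ d∣N d∣k%N → ∣n∣m%n⇒∣m d∣N d∣k%N)

  module Cofactor {e : ℕ} (e∣r : e ∣ r) where

    M : ℕ
    M = quotient e∣r

    r≡e*M : r ≡ e * M
    r≡e*M = m∣n⇒n≡m*quotient e∣r

    instance
      e≢0 : NonZero e
      e≢0 = m*n≢0⇒m≢0 e {{subst NonZero r≡e*M it}}
      M≢0 : NonZero M
      M≢0 = m*n≢0⇒n≢0 e {{subst NonZero r≡e*M it}}
      e^s≢0 : NonZero (e ^ s)
      e^s≢0 = m^n≢0 e s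
      M^s≢0 : NonZero (M ^ s)
      M^s≢0 = m^n≢0 M s

    N≡e^s*M^s : N ≡ e ^ s * M ^ s
    N≡e^s*M^s = trans (cong (_^ s) r≡e*M) (^-distribʳ-* e M s)

    M∣r : M ∣ r
    M∣r = subst (M ∣_) (sym r≡e*M) (n∣m*n e)

    M^s∣G⇔N∣e^s* : ∀ m → M ^ s ∣ G m ⇔ N ∣ e ^ s * m
    M^s∣G⇔N∣e^s* m = mk⇔
      (λ M^s∣Gm → subst (_∣ e ^ s * m) (sym N≡e^s*M^s) (*-monoʳ-∣ (e ^ s) (∣-trans M^s∣Gm (G∣ m))))
      (λ N∣e^s*m → subst (M ^ s ∣_) (sym (G≡base^s m)) (^-monoˡ-∣ s
        (Equivalence.from (∣base⇔^s∣ m M∣r)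
          (*-cancelˡ-∣ (e ^ s) (subst (_∣ e ^ s * m) N≡e^s*M^s N∣e^s*m)))))

    G[e^s*j]≡e^s⇔gcdPow[j,M^s]≡1 : ∀ j → G (e ^ s * j) ≡ e ^ s ⇔ gcdPow s j (M ^ s) ≡ 1
    G[e^s*j]≡e^s⇔gcdPow[j,M^s]≡1 j = mk⇔ to from
      where
        k = e ^ s * j
        open IsGcdPow (gcdPow-spec j (M ^ s)) renaming (base to L; v≡base^s to gcdPow≡L^s)

        e∣base : e ∣ base k
        e∣base = Equivalence.from (∣base⇔^s∣ k e∣r) (m∣m*n j)

        e*-∣r : ∀ {l} → l ∣ M → e * l ∣ r
        e*-∣r l∣M = subst (_ ∣_) (sym r≡e*M) (*-monoʳ-∣ e l∣M)

        e^s*-cancel : ∀ {l} → (e * l) ^ s ∣ k → l ^ s ∣ j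
        e^s*-cancel {l} = *-cancelˡ-∣ (e ^ s) ∘ subst (_∣ k) (^-distribʳ-* e l s)

        to : G k ≡ e ^ s → gcdPow s j (M ^ s) ≡ 1
        to G≡e^s = trans gcdPow≡L^s (trans (cong (_^ s) L≡1) (^-zeroˡ s))
          where
            e*L∣e*1 : e * L ∣ e * 1
            e*L∣e*1 = subst (e * L ∣_) (trans (G≡e^s⇒base≡e G≡e^s) (sym (*-identityʳ e)))
              (Equivalence.from (∣base⇔^s∣ k (e*-∣r (^-cancelˡ-∣ s (proj₂ common))))
                (subst (_∣ k) (sym (^-distribʳ-* e L s)) (*-monoʳ-∣ (e ^ s) (proj₁ common))))
            L≡1 : L ≡ 1
            L≡1 = ∣1⇒≡1 (*-cancelˡ-∣ e e*L∣e*1)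

        from : gcdPow s j (M ^ s) ≡ 1 → G k ≡ e ^ s
        from gcdPow≡1 = trans (G≡base^s k) (cong (_^ s) base≡e)
          where
            L≡1 : L ≡ 1
            L≡1 = ^-injectiveˡ s (trans (sym gcdPow≡L^s) (trans gcdPow≡1 (sym (^-zeroˡ s))))
            L′ = quotient e∣base
            base≡e*L′ : base k ≡ e * L′
            base≡e*L′ = m∣n⇒n≡m*quotient e∣base
            L′∣1 : L′ ∣ 1
            L′∣1 = subst (L′ ∣_) L≡1 (greatest
              ( e^s*-cancel (subst (λ b → b ^ s ∣ k) base≡e*L′ (base^s∣ k))
              , ^-monoˡ-∣ s (*-cancelˡ-∣ e (subst₂ _∣_ base≡e*L′ r≡e*M (base∣r k)))))
            base≡e : base k ≡ e
            base≡e = trans base≡e*L′ (trans (cong (e *_) (∣1⇒≡1 L′∣1)) (*-identityʳ e))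

module Sums {c ℓ} (K : CommutativeRing c ℓ) where

  open import Data.Nat.Base as ℕ using (zero; suc; s≤s)
  import Data.Nat.Properties as ℕ
  open import Data.Nat.Divisibility using (_∣_; n∣m*n; ∣m+n∣m⇒∣n; ∣⇒≤)
  open import Data.Bool using (Bool; true; false; if_then_else_; _∧_; T)
  open import Data.Empty using (⊥-elim)
  open import Data.Sum using (inj₁; inj₂)
  open import Function.Base using (_∘_)
  open import Relation.Binary.PropositionalEquality as ≡ using (_≡_; _≢_)
  open import Relation.Nullary using (¬_)
  open CommutativeRing K
  open Setup K
  open import Algebra.Properties.CommutativeSemigroup +-commutativeSemigroup using (interchange)
  open import Algebra.Properties.Group +-group using () renaming (∙-cancelʳ to +-cancelʳ)
  open import Relation.Binary.Reasoning.Setoid setoid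

  sum1-cong : ∀ n {h h′ : ℕ → Carrier} → (∀ k → 0 ℕ.< k → k ℕ.≤ n → h k ≈ h′ k) → sum1 n h ≈ sum1 n h′
  sum1-cong zero    h≈h′ = refl
  sum1-cong (suc n) h≈h′ =
    +-cong (sum1-cong n λ k 0<k k≤n → h≈h′ k 0<k (ℕ.m≤n⇒m≤1+n k≤n)) (h≈h′ (suc n) ℕ.z<s ℕ.≤-refl)

  sum1-zero : ∀ n {h : ℕ → Carrier} → (∀ k → 0 ℕ.< k → k ℕ.≤ n → h k ≈ 0#) → sum1 n h ≈ 0#
  sum1-zero zero    h≈0 = refl
  sum1-zero (suc n) h≈0 =
    trans (+-cong (sum1-zero n λ k 0<k k≤n → h≈0 k 0<k (ℕ.m≤n⇒m≤1+n k≤n)) (h≈0 (suc n) ℕ.z<s ℕ.≤-refl))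
          (+-identityˡ 0#)

  sum1-distrib-+ : ∀ n (h h′ : ℕ → Carrier) → sum1 n (λ k → h k + h′ k) ≈ sum1 n h + sum1 n h′
  sum1-distrib-+ zero    h h′ = sym (+-identityˡ 0#)
  sum1-distrib-+ (suc n) h h′ =
    trans (+-congʳ (sum1-distrib-+ n h h′)) (interchange (sum1 n h) (sum1 n h′) (h (suc n)) (h′ (suc n)))

  *-distribˡ-sum1 : ∀ n a (h : ℕ → Carrier) → a * sum1 n h ≈ sum1 n (λ k → a * h k)
  *-distribˡ-sum1 zero    a h = zeroʳ a
  *-distribˡ-sum1 (suc n) a h = trans (distribˡ a (sum1 n h) (h (suc n))) (+-congʳ (*-distribˡ-sum1 n a h))

  *-distribʳ-sum1 : ∀ n a (h : ℕ → Carrier) → sum1 n h * a ≈ sum1 n (λ k → h k * a)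
  *-distribʳ-sum1 n a h =
    trans (*-comm _ a) (trans (*-distribˡ-sum1 n a h) (sum1-cong n λ k _ _ → *-comm a (h k)))

  sum1-swap : ∀ n m (h : ℕ → ℕ → Carrier) →
              sum1 n (λ i → sum1 m (h i)) ≈ sum1 m (λ j → sum1 n (λ i → h i j))
  sum1-swap zero    m h = sym (sum1-zero m λ _ _ _ → refl)
  sum1-swap (suc n) m h =
    trans (+-congʳ (sum1-swap n m h)) (sym (sum1-distrib-+ m (λ j → sum1 n (λ i → h i j)) (h (suc n))))

  sum1-single : ∀ n (h : ℕ → Carrier) {k₀} → 0 ℕ.< k₀ → k₀ ℕ.≤ n →
                (∀ k → 0 ℕ.< k → k ℕ.≤ n → k ≢ k₀ → h k ≈ 0#) → sum1 n h ≈ h k₀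
  sum1-single zero    h 0<k₀ k₀≤0 _ = ⊥-elim (ℕ.<⇒≱ 0<k₀ k₀≤0)
  sum1-single (suc n) h 0<k₀ k₀≤n+1 h≈0 with ℕ.m≤n⇒m<n∨m≡n k₀≤n+1
  ... | inj₂ ≡.refl =
    trans (+-congʳ (sum1-zero n λ k 0<k k≤n → h≈0 k 0<k (ℕ.m≤n⇒m≤1+n k≤n) (ℕ.<⇒≢ (s≤s k≤n))))
          (+-identityˡ _)
  ... | inj₁ k₀<n+1 =
    trans (+-cong (sum1-single n h 0<k₀ (ℕ.s≤s⁻¹ k₀<n+1) λ k 0<k k≤n → h≈0 k 0<k (ℕ.m≤n⇒m≤1+n k≤n))
                  (h≈0 (suc n) ℕ.z<s ℕ.≤-refl (ℕ.>⇒≢ k₀<n+1)))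
          (+-identityʳ _)

  sum1-suc : ∀ n (h : ℕ → Carrier) → sum1 (suc n) h ≈ h 1 + sum1 n (h ∘ suc)
  sum1-suc zero    h = trans (+-identityˡ _) (sym (+-identityʳ _))
  sum1-suc (suc n) h = trans (+-congʳ (sum1-suc n h)) (+-assoc _ _ _)

  sum1-+ : ∀ n m (h : ℕ → Carrier) → sum1 (n ℕ.+ m) h ≈ sum1 n h + sum1 m (λ i → h (n ℕ.+ i))
  sum1-+ n zero    h rewrite ℕ.+-identityʳ n = sym (+-identityʳ _)
  sum1-+ n (suc m) h rewrite ℕ.+-suc n m = trans (+-congʳ (sum1-+ n m h)) (+-assoc _ _ _)

  sum1-multiples : ∀ A B .{{_ : NonZero A}} (h : ℕ → Carrier) → (∀ k → ¬ A ∣ k → h k ≈ 0#) →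
                   sum1 (B ℕ.* A) h ≈ sum1 B (λ j → h (j ℕ.* A))
  sum1-multiples A zero    h h≈0 = refl
  sum1-multiples A (suc B) h h≈0 = begin
    sum1 (A ℕ.+ B ℕ.* A) h                             ≡⟨ ≡.cong (λ n → sum1 n h) (ℕ.+-comm A (B ℕ.* A)) ⟩
    sum1 (B ℕ.* A ℕ.+ A) h                             ≈⟨ sum1-+ (B ℕ.* A) A h ⟩
    sum1 (B ℕ.* A) h + sum1 A (λ i → h (B ℕ.* A ℕ.+ i)) ≈⟨ +-cong (sum1-multiples A B h h≈0) last-block ⟩
    sum1 B (λ j → h (j ℕ.* A)) + h (A ℕ.+ B ℕ.* A)     ∎
    where
      last-block : sum1 A (λ i → h (B ℕ.* A ℕ.+ i)) ≈ h (A ℕ.+ B ℕ.* A)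
      last-block = trans
        (sum1-single A _ (ℕ.>-nonZero⁻¹ A) ℕ.≤-refl λ i 0<i i≤A i≢A → h≈0 _ λ A∣B*A+i →
          i≢A (ℕ.≤-antisym i≤A (∣⇒≤ {{ℕ.>-nonZero 0<i}} (∣m+n∣m⇒∣n A∣B*A+i (n∣m*n B)))))
        (reflexive (≡.cong h (ℕ.+-comm (B ℕ.* A) A)))

  sum1-shift-periodic : ∀ N c (h : ℕ → Carrier) → (∀ x → h (x ℕ.+ N) ≈ h x) →
                        sum1 N (λ n → h (n ℕ.+ c)) ≈ sum1 N h
  sum1-shift-periodic N zero    h h-periodic = sum1-cong N λ n _ _ → reflexive (≡.cong h (ℕ.+-identityʳ n))
  sum1-shift-periodic N (suc c) h h-periodic = begin
    sum1 N (λ n → h (n ℕ.+ suc c)) ≈⟨ sum1-cong N (λ n _ _ → reflexive (≡.cong h (ℕ.+-suc n c))) ⟩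
    sum1 N (h+c ∘ suc)             ≈⟨ +-cancelʳ (h+c 1) _ _ rotate ⟩
    sum1 N h+c                     ≈⟨ sum1-shift-periodic N c h h-periodic ⟩
    sum1 N h                       ∎
    where
      h+c : ℕ → Carrier
      h+c n = h (n ℕ.+ c)
      rotate : sum1 N (h+c ∘ suc) + h+c 1 ≈ sum1 N h+c + h+c 1
      rotate = begin
        sum1 N (h+c ∘ suc) + h+c 1 ≈⟨ +-comm _ _ ⟩
        h+c 1 + sum1 N (h+c ∘ suc) ≈⟨ sum1-suc N h+c ⟨
        sum1 N h+c + h+c (suc N)   ≈⟨ +-congˡ (trans (reflexive (≡.cong (h ∘ suc) (ℕ.+-comm N c)))
                                                     (h-periodic (suc c))) ⟩
        sum1 N h+c + h+c 1         ∎

  ∧-intro : ∀ {a b} → T a → T b → T (a ∧ b)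
  ∧-intro {true} _ t = t

  ∧-elimˡ : ∀ a {b} → T (a ∧ b) → T a
  ∧-elimˡ true _ = _

  ∧-elimʳ : ∀ a {b} → T (a ∧ b) → T b
  ∧-elimʳ true t = t

  T-injective : ∀ {a b} → (T a → T b) → (T b → T a) → a ≡ b
  T-injective {true}  {true}  _ _ = ≡.refl
  T-injective {true}  {false} f _ = ⊥-elim (f _)
  T-injective {false} {true}  _ g = ⊥-elim (g _)
  T-injective {false} {false} _ _ = ≡.refl

  if-T : ∀ {b x} → T b → (if b then x else 0#) ≈ x
  if-T {true} _ = refl

  if-¬T : ∀ {b x} → ¬ T b → (if b then x else 0#) ≈ 0#
  if-¬T {true}  ¬t = ⊥-elim (¬t _)
  if-¬T {false} _  = refl

  if-split : ∀ b x → x ≈ (if b then x else 0#) + (if b then 0# else x)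
  if-split true  x = sym (+-identityʳ x)
  if-split false x = sym (+-identityˡ x)

  sum1-if-unique : ∀ n (b : ℕ → Bool) (x : ℕ → Carrier) {k₀} → 0 ℕ.< k₀ → k₀ ℕ.≤ n → T (b k₀) →
                   (∀ k → 0 ℕ.< k → k ℕ.≤ n → T (b k) → k ≡ k₀) →
                   sum1 n (λ k → if b k then x k else 0#) ≈ x k₀
  sum1-if-unique n b x 0<k₀ k₀≤n b[k₀] unique =
    trans (sum1-single n _ 0<k₀ k₀≤n λ k 0<k k≤n k≢k₀ → if-¬T (k≢k₀ ∘ unique k 0<k k≤n)) (if-T b[k₀])

  sum1-if-none : ∀ n (b : ℕ → Bool) (x : ℕ → Carrier) → (∀ k → 0 ℕ.< k → k ℕ.≤ n → ¬ T (b k)) →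
                 sum1 n (λ k → if b k then x k else 0#) ≈ 0#
  sum1-if-none n b x none = sum1-zero n λ k 0<k k≤n → if-¬T (none k 0<k k≤n)

module RootsOfUnity {c ℓ} (K : CommutativeRing c ℓ) where

  open import Data.Nat.Base as ℕ using (zero; suc; _%_)
  import Data.Nat.Properties as ℕ
  open import Data.Nat.Divisibility using (_∣_; divides; n∣m*n; m%n≡0⇒n∣m)
  open import Data.Nat.DivMod using (m≡m%n+[m/n]*n; m%n<n; _/_)
  open import Data.Empty using (⊥-elim)
  open import Data.Sum using (_⊎_; inj₁; inj₂)
  open import Relation.Binary.PropositionalEquality as ≡ using (_≡_)
  open import Relation.Nullary using (¬_)
  open CommutativeRing K
  open Setup K
  open Sums K
  open import Algebra.Definitions.RawSemiring (Semiring.rawSemiring semiring) using (_^_)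
  open import Algebra.Properties.Semiring.Exp semiring using (^-homo-*; ^-assocʳ; ^-congˡ)
  open import Algebra.Properties.CommutativeSemigroup +-commutativeSemigroup using (xy∙z≈xz∙y)
  open import Algebra.Properties.Group +-group using (x∙y⁻¹≈ε⇒x≈y) renaming (∙-cancelʳ to +-cancelʳ)
  open import Algebra.Properties.Ring ring using (-1*x≈-x)
  open import Relation.Binary.Reasoning.Setoid setoid

  geometric : Carrier → ℕ → Carrier
  geometric x n = sum1 n (x ^_)

  1#^n≈1# : ∀ n → 1# ^ n ≈ 1#
  1#^n≈1# zero    = refl
  1#^n≈1# (suc n) = trans (*-identityˡ _) (1#^n≈1# n)

  geometric-1 : ∀ {x} n → x ≈ 1# → geometric x n ≈ natK n
  geometric-1 zero    x≈1 = refl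
  geometric-1 (suc n) x≈1 =
    trans (+-cong (geometric-1 n x≈1) (trans (^-congˡ (suc n) x≈1) (1#^n≈1# (suc n)))) (+-comm _ _)

  *-geometric : ∀ x n → x * geometric x n + x ≈ geometric x n + x ^ suc n
  *-geometric x zero    = trans (+-congʳ (zeroʳ x)) (+-congˡ (sym (*-identityʳ x)))
  *-geometric x (suc n) = begin
    x * (geometric x n + x ^ suc n) + x     ≈⟨ +-congʳ (distribˡ x _ _) ⟩
    x * geometric x n + x * x ^ suc n + x   ≈⟨ xy∙z≈xz∙y _ _ _ ⟩
    x * geometric x n + x + x * x ^ suc n   ≈⟨ +-congʳ (*-geometric x n) ⟩
    geometric x n + x ^ suc n + x ^ suc (suc n) ∎

  NoZeroDivisors : Set _
  NoZeroDivisors = ∀ x y → x * y ≈ 0# → x ≈ 0# ⊎ y ≈ 0#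

  -- (x - 1) S = x S - S = 0 by *-geometric, and x - 1 is not zero.
  geometric-0 : NoZeroDivisors → ∀ {x} n → x ^ n ≈ 1# → ¬ x ≈ 1# → geometric x n ≈ 0#
  geometric-0 noZeroDivisors {x} n x^n≈1 x≉1 with noZeroDivisors (x - 1#) S [x-1]S≈0
    where
      S = geometric x n
      xS≈S : x * S ≈ S
      xS≈S = +-cancelʳ x _ _ (trans (*-geometric x n) (+-congˡ (trans (*-congˡ x^n≈1) (*-identityʳ x))))
      [x-1]S≈0 : (x - 1#) * S ≈ 0#
      [x-1]S≈0 = begin
        (x - 1#) * S     ≈⟨ distribʳ S x (- 1#) ⟩
        x * S + - 1# * S ≈⟨ +-cong xS≈S (-1*x≈-x S) ⟩
        S - S            ≈⟨ -‿inverseʳ S ⟩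
        0#               ∎
  ... | inj₁ x-1≈0 = ⊥-elim (x≉1 (x∙y⁻¹≈ε⇒x≈y x 1# x-1≈0))
  ... | inj₂ S≈0   = S≈0

  module Primitive (N : ℕ) .{{_ : NonZero N}} {ω : Carrier} (ω^N≈1 : ω ^ N ≈ 1#)
                   (ω^k≉1 : ∀ k → 0 ℕ.< k → k ℕ.< N → ¬ ω ^ k ≈ 1#) where

    ^-multiple : ∀ {X} → N ∣ X → ω ^ X ≈ 1#
    ^-multiple {X} (divides q X≡q*N) = begin
      ω ^ X         ≡⟨ ≡.cong (ω ^_) (≡.trans X≡q*N (ℕ.*-comm q N)) ⟩
      ω ^ (N ℕ.* q) ≈⟨ ^-assocʳ ω N q ⟨
      (ω ^ N) ^ q   ≈⟨ ^-congˡ q ω^N≈1 ⟩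
      1# ^ q        ≈⟨ 1#^n≈1# q ⟩
      1#            ∎

    ^-+-multiple : ∀ a {X} → N ∣ X → ω ^ (a ℕ.+ X) ≈ ω ^ a
    ^-+-multiple a N∣X = trans (^-homo-* ω a _) (trans (*-congˡ (^-multiple N∣X)) (*-identityʳ _))

    ^-mod : ∀ X → ω ^ X ≈ ω ^ (X % N)
    ^-mod X = trans (reflexive (≡.cong (ω ^_) (m≡m%n+[m/n]*n X N))) (^-+-multiple (X % N) (n∣m*n (X / N)))

    ^≈1⇒∣ : ∀ {X} → ω ^ X ≈ 1# → N ∣ X
    ^≈1⇒∣ {X} ω^X≈1 with X % N in X%N≡
    ... | zero  = m%n≡0⇒n∣m X N X%N≡
    ... | suc k = ⊥-elim (ω^k≉1 (suc k) ℕ.z<s (≡.subst (ℕ._< N) X%N≡ (m%n<n X N))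
                    (trans (reflexive (≡.cong (ω ^_) (≡.sym X%N≡))) (trans (sym (^-mod X)) ω^X≈1)))

module ClassSums {c ℓ} (K : CommutativeRing c ℓ) (s : ℕ) .{{_ : NonZero s}} (r : ℕ) .{{_ : NonZero r}} where

  open import Data.Nat.Base as ℕ using (_≡ᵇ_)
  import Data.Nat.Properties as ℕ
  open import Data.Nat.Divisibility using (_∣?_; ∣⇒≤)
  open import Data.Bool using (Bool; true; false; if_then_else_; _∧_; T)
  open import Relation.Binary.PropositionalEquality as ≡ using (_≡_)
  open import Relation.Nullary.Decidable using (⌊_⌋; fromWitness)
  open CommutativeRing K
  open Setup K
  open Sums K
  open Classes s r
  open import Relation.Binary.Reasoning.Setoid setoid

  ClassFunction : (ℕ → Carrier) → Set ℓ
  ClassFunction h = ∀ {m m′} → 0 ℕ.< m → 0 ℕ.< m′ → G m ≡ G m′ → h m ≈ h m′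

  isEven⇒classFunction : ∀ {h} → IsEven r s h → ClassFunction h
  isEven⇒classFunction {h} h-even {m} {m′} 0<m 0<m′ Gm≡Gm′ = begin
    h m     ≈⟨ h-even m (ℕ.>-nonZero 0<m) ⟩
    h (G m)  ≡⟨ ≡.cong h Gm≡Gm′ ⟩
    h (G m′) ≈⟨ h-even m′ (ℕ.>-nonZero 0<m′) ⟨
    h m′    ∎

  classFunction⇒isEven : ∀ {h} → ClassFunction h → IsEven r s h
  classFunction⇒isEven h-class n n≢0 = h-class (ℕ.>-nonZero⁻¹ n {{n≢0}}) (G>0 n) (≡.sym (G-idem n))

  inClass : ℕ → ℕ → Bool
  inClass e k = G k ≡ᵇ e ℕ.^ s

  classSum : ℕ → (ℕ → Carrier) → Carrier
  classSum e F = sum1 N (λ k → if inClass e k then F k else 0#)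

  inClass⇒G≡ : ∀ {e k} → T (inClass e k) → G k ≡ e ℕ.^ s
  inClass⇒G≡ {e} {k} = ℕ.≡ᵇ⇒≡ (G k) (e ℕ.^ s)

  inClass⇒≡base : ∀ {e k} → T (inClass e k) → e ≡ base k
  inClass⇒≡base t = ≡.sym (G≡e^s⇒base≡e (inClass⇒G≡ t))

  inClass-base : ∀ k → T (inClass (base k) k)
  inClass-base k = ℕ.≡⇒≡ᵇ (G k) _ (G≡base^s k)

  -- The classes {k ≤ N : G k = e ^ s}, e ∣ r, partition {1, …, N}.
  classDecomposition : ∀ (P : ℕ → Bool) (F : ℕ → Carrier) →
    sum1 r (λ e → if ⌊ e ∣? r ⌋ then (if P e then classSum e F else 0#) else 0#) ≈
    sum1 N (λ k → if P (base k) then F k else 0#)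
  classDecomposition P F = begin
    sum1 r (λ e → if ⌊ e ∣? r ⌋ then (if P e then classSum e F else 0#) else 0#)
      ≈⟨ sum1-cong r (λ e _ _ → expand e) ⟩
    sum1 r (λ e → sum1 N (λ k → if ⌊ e ∣? r ⌋ ∧ P e ∧ inClass e k then F k else 0#))
      ≈⟨ sum1-swap r N _ ⟩
    sum1 N (λ k → sum1 r (λ e → if ⌊ e ∣? r ⌋ ∧ P e ∧ inClass e k then F k else 0#))
      ≈⟨ sum1-cong N (λ k _ _ → collapse k) ⟩
    sum1 N (λ k → if P (base k) then F k else 0#) ∎
    where
      expand : ∀ e → (if ⌊ e ∣? r ⌋ then (if P e then classSum e F else 0#) else 0#) ≈
                     sum1 N (λ k → if ⌊ e ∣? r ⌋ ∧ P e ∧ inClass e k then F k else 0#)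
      expand e with ⌊ e ∣? r ⌋ | P e
      ... | true  | true  = refl
      ... | true  | false = sym (sum1-zero N λ _ _ _ → refl)
      ... | false | _     = sym (sum1-zero N λ _ _ _ → refl)
      collapse : ∀ k → sum1 r (λ e → if ⌊ e ∣? r ⌋ ∧ P e ∧ inClass e k then F k else 0#) ≈
                       (if P (base k) then F k else 0#)
      collapse k with P (base k) in P[base]
      ... | true  = sum1-if-unique r _ _ (base>0 k) (∣⇒≤ (base∣r k))
                      (∧-intro (fromWitness {a? = base k ∣? r} (base∣r k))
                               (∧-intro (≡.subst T (≡.sym P[base]) _) (inClass-base k)))
                      λ e _ _ t → inClass⇒≡base (∧-elimʳ (P e) (∧-elimʳ ⌊ e ∣? r ⌋ t))
      ... | false = sum1-if-none r _ _ λ e _ _ t →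
                      let t′ = ∧-elimʳ ⌊ e ∣? r ⌋ t in
                      ≡.subst T (≡.trans (≡.cong P (inClass⇒≡base (∧-elimʳ (P e) t′))) P[base])
                                (∧-elimˡ (P e) t′)

  classSum-*ˡ : ∀ {h} → ClassFunction h → ∀ {e} → 0 ℕ.< e → ∀ ψ →
                h (e ℕ.^ s) * classSum e ψ ≈ classSum e (λ k → h k * ψ k)
  classSum-*ˡ {h} h-class {e} 0<e ψ = trans (*-distribˡ-sum1 N _ _) (sum1-cong N termwise)
    where
      termwise : ∀ k → 0 ℕ.< k → k ℕ.≤ N →
                 h (e ℕ.^ s) * (if inClass e k then ψ k else 0#) ≈ (if inClass e k then h k * ψ k else 0#)
      termwise k 0<k _ with inClass e k in k∈class
      ... | false = zeroʳ _
      ... | true  = *-congʳ (h-class (ℕ.m^n>0 e {{ℕ.>-nonZero 0<e}} s) 0<k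
                      (≡.trans (≡.cong G (≡.sym G≡e^s)) (G-idem k)))
        where G≡e^s = inClass⇒G≡ (≡.subst T (≡.sym k∈class) _)

  sum1-by-classes : ∀ {h} → ClassFunction h → ∀ ψ →
    sum1 N (λ k → h k * ψ k) ≈ sum1 r (λ e → if ⌊ e ∣? r ⌋ then h (e ℕ.^ s) * classSum e ψ else 0#)
  sum1-by-classes {h} h-class ψ = sym (trans (sum1-cong r termwise) (classDecomposition (λ _ → true) _))
    where
      termwise : ∀ e → 0 ℕ.< e → e ℕ.≤ r →
                 (if ⌊ e ∣? r ⌋ then h (e ℕ.^ s) * classSum e ψ else 0#) ≈
                 (if ⌊ e ∣? r ⌋ then classSum e (λ k → h k * ψ k) else 0#)
      termwise e 0<e _ with ⌊ e ∣? r ⌋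
      ... | true  = classSum-*ˡ h-class 0<e ψ
      ... | false = refl

module RamanujanSums {c ℓ} (K : CommutativeRing c ℓ) (s : ℕ) .{{_ : NonZero s}} (r : ℕ) .{{_ : NonZero r}} where

  open import Data.Nat.Base as ℕ using (suc; _≡ᵇ_)
  import Data.Nat.Properties as ℕ
  open import Data.Nat.Divisibility using (_∣_; _∣?_; ∣⇒≤; ∣-refl; n∣m*n; m∣m*n; n/m≡quotient)
  open import Data.Nat.DivMod using (_/_; /-congʳ)
  open import Data.Nat.Solver using (module +-*-Solver)
  open import Data.Bool using (true; false; if_then_else_; T)
  open import Data.Empty using (⊥-elim)
  open import Function.Base using (_∘_)
  open import Function.Bundles using (Equivalence)
  open import Relation.Binary.PropositionalEquality as ≡ using (_≡_)
  open import Relation.Nullary using (yes; no; ¬_)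
  open import Relation.Nullary.Decidable using (⌊_⌋; toWitness; fromWitness)
  open CommutativeRing K
  open Setup K
  open import Algebra.Definitions.RawSemiring (Semiring.rawSemiring semiring) using (_^_)
  open import Algebra.Properties.Semiring.Exp semiring using (^-assocʳ)
  open import Algebra.Properties.Group +-group using (x≈z//y)
  open Sums K
  open RootsOfUnity K
  open Classes s r
  open ClassSums K s r
  open import Relation.Binary.Reasoning.Setoid setoid

  module PrimitiveRoot (noZeroDivisors : NoZeroDivisors) {ω : Carrier} (ω^N≈1 : ω ^ N ≈ 1#)
                       (ω^k≉1 : ∀ k → 0 ℕ.< k → k ℕ.< N → ¬ ω ^ k ≈ 1#) where

    open Primitive N ω^N≈1 ω^k≉1

    ramanujanSum : ℕ → ℕ → Carrier
    ramanujanSum e m = classSum e (λ k → ω ^ (k ℕ.* m))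

    powerSum : ℕ → ℕ → Carrier
    powerSum e m = sum1 N (λ k → if ⌊ e ℕ.^ s ∣? k ⌋ then ω ^ (k ℕ.* m) else 0#)

    -- Substituting k = j e ^ s gives the geometric sum of x = ω ^ (e ^ s m) of length M ^ s,
    -- and x = 1 exactly when N = e ^ s M ^ s divides e ^ s m.
    powerSum≈ : ∀ {e} (e∣r : e ∣ r) m → let open Cofactor e∣r in
                powerSum e m ≈ (if ⌊ M ℕ.^ s ∣? G m ⌋ then natK (M ℕ.^ s) else 0#)
    powerSum≈ {e} e∣r m = begin
      powerSum e m
        ≡⟨ ≡.cong (λ n → sum1 n φ) (≡.trans N≡e^s*M^s (ℕ.*-comm (e ℕ.^ s) _)) ⟩
      sum1 (M ℕ.^ s ℕ.* e ℕ.^ s) φ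
        ≈⟨ sum1-multiples (e ℕ.^ s) (M ℕ.^ s) φ (λ k e^s∤k → if-¬T (e^s∤k ∘ toWitness {a? = e ℕ.^ s ∣? k})) ⟩
      sum1 (M ℕ.^ s) (λ j → φ (j ℕ.* e ℕ.^ s))
        ≈⟨ sum1-cong (M ℕ.^ s) (λ j _ _ → φ[j*e^s]≈x^j j) ⟩
      geometric x (M ℕ.^ s)
        ≈⟨ closed ⟩
      (if ⌊ M ℕ.^ s ∣? G m ⌋ then natK (M ℕ.^ s) else 0#) ∎
      where
        open Cofactor e∣r
        φ : ℕ → Carrier
        φ k = if ⌊ e ℕ.^ s ∣? k ⌋ then ω ^ (k ℕ.* m) else 0#
        x : Carrier
        x = ω ^ (e ℕ.^ s ℕ.* m)
        φ[j*e^s]≈x^j : ∀ j → φ (j ℕ.* e ℕ.^ s) ≈ x ^ j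
        φ[j*e^s]≈x^j j = begin
          φ (j ℕ.* e ℕ.^ s)         ≈⟨ if-T (fromWitness {a? = e ℕ.^ s ∣? _} (n∣m*n j)) ⟩
          ω ^ (j ℕ.* e ℕ.^ s ℕ.* m) ≡⟨ ≡.cong (ω ^_) (≡.trans (ℕ.*-assoc j _ m) (ℕ.*-comm j _)) ⟩
          ω ^ (e ℕ.^ s ℕ.* m ℕ.* j) ≈⟨ ^-assocʳ ω (e ℕ.^ s ℕ.* m) j ⟨
          x ^ j                     ∎
        x^M^s≈1 : x ^ (M ℕ.^ s) ≈ 1#
        x^M^s≈1 = trans (^-assocʳ ω (e ℕ.^ s ℕ.* m) (M ℕ.^ s))
                        (^-multiple (≡.subst (N ∣_) N*m≡ (m∣m*n m)))
          where
            open import Algebra.Properties.CommutativeSemigroup ℕ.*-commutativeSemigroup using (xy∙z≈xz∙y)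
            N*m≡ : N ℕ.* m ≡ e ℕ.^ s ℕ.* m ℕ.* M ℕ.^ s
            N*m≡ = ≡.trans (≡.cong (ℕ._* m) N≡e^s*M^s) (xy∙z≈xz∙y (e ℕ.^ s) _ m)
        closed : geometric x (M ℕ.^ s) ≈ (if ⌊ M ℕ.^ s ∣? G m ⌋ then natK (M ℕ.^ s) else 0#)
        closed with M ℕ.^ s ∣? G m
        ... | yes M^s∣Gm = geometric-1 (M ℕ.^ s) (^-multiple (Equivalence.to (M^s∣G⇔N∣e^s* m) M^s∣Gm))
        ... | no  M^s∤Gm = geometric-0 noZeroDivisors (M ℕ.^ s) x^M^s≈1
                             (M^s∤Gm ∘ Equivalence.from (M^s∣G⇔N∣e^s* m) ∘ ^≈1⇒∣)

    multiplesTerm : ℕ → ℕ → ℕ → Carrier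
    multiplesTerm e m e′ = if ⌊ e′ ∣? r ⌋ then (if ⌊ e ∣? e′ ⌋ then ramanujanSum e′ m else 0#) else 0#

    multiplesSum : ℕ → ℕ → Carrier
    multiplesSum e m = sum1 r (multiplesTerm e m)

    properMultiplesSum : ℕ → ℕ → Carrier
    properMultiplesSum e m = sum1 r (λ e′ → if e′ ≡ᵇ e then 0# else multiplesTerm e m e′)

    multiplesSum≈powerSum : ∀ {e} → e ∣ r → ∀ m → multiplesSum e m ≈ powerSum e m
    multiplesSum≈powerSum {e} e∣r m =
      trans (classDecomposition (λ e′ → ⌊ e ∣? e′ ⌋) _) (sum1-cong N λ k _ _ → termwise k)
      where
        termwise : ∀ k → (if ⌊ e ∣? base k ⌋ then ω ^ (k ℕ.* m) else 0#) ≈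
                         (if ⌊ e ℕ.^ s ∣? k ⌋ then ω ^ (k ℕ.* m) else 0#)
        termwise k with e ∣? base k | e ℕ.^ s ∣? k
        ... | yes _      | yes _      = refl
        ... | no  _      | no  _      = refl
        ... | yes e∣base | no  e^s∤k  = ⊥-elim (e^s∤k (Equivalence.to (∣base⇔^s∣ k e∣r) e∣base))
        ... | no  e∤base | yes e^s∣k  = ⊥-elim (e∤base (Equivalence.from (∣base⇔^s∣ k e∣r) e^s∣k))

    multiplesSum≈ramanujanSum+properMultiplesSum : ∀ {e} → e ∣ r → ∀ m →
      multiplesSum e m ≈ ramanujanSum e m + properMultiplesSum e m
    multiplesSum≈ramanujanSum+properMultiplesSum {e} e∣r m = begin
      multiplesSum e m
        ≈⟨ sum1-cong r (λ e′ _ _ → if-split (e′ ≡ᵇ e) (multiplesTerm e m e′)) ⟩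
      sum1 r (λ e′ → (if e′ ≡ᵇ e then multiplesTerm e m e′ else 0#) +
                     (if e′ ≡ᵇ e then 0# else multiplesTerm e m e′))
        ≈⟨ sum1-distrib-+ r _ _ ⟩
      sum1 r (λ e′ → if e′ ≡ᵇ e then multiplesTerm e m e′ else 0#) + properMultiplesSum e m
        ≈⟨ +-congʳ (sum1-if-unique r _ _ 0<e (∣⇒≤ e∣r) (ℕ.≡⇒≡ᵇ e e ≡.refl) λ e′ _ _ → ℕ.≡ᵇ⇒≡ e′ e) ⟩
      multiplesTerm e m e + properMultiplesSum e m
        ≈⟨ +-congʳ multiplesTerm[e]≈ramanujanSum ⟩
      ramanujanSum e m + properMultiplesSum e m ∎
      where
        open Cofactor e∣r using (e≢0)
        0<e = ℕ.>-nonZero⁻¹ e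
        multiplesTerm[e]≈ramanujanSum : multiplesTerm e m e ≈ ramanujanSum e m
        multiplesTerm[e]≈ramanujanSum with e ∣? r | e ∣? e
        ... | yes _ | yes _   = refl
        ... | no e∤r | _      = ⊥-elim (e∤r e∣r)
        ... | yes _ | no e∤e  = ⊥-elim (e∤e ∣-refl)

    -- Downward induction on e: R_e = powerSum e − (sum of R_e′ over proper multiples e′ of e),
    -- where powerSum e depends only on G m by powerSum≈.
    ramanujanSum-classFunction′ : ∀ fuel {e} → r ℕ.∸ e ℕ.< fuel → e ∣ r → ClassFunction (ramanujanSum e)
    ramanujanSum-classFunction′ (suc fuel) {e} r∸e<1+fuel e∣r {m} {m′} 0<m 0<m′ Gm≡Gm′ = begin
      ramanujanSum e m                          ≈⟨ ramanujanSum≈ m ⟩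
      powerSum e m - properMultiplesSum e m     ≈⟨ +-cong powerSum-cong (-‿cong properMultiplesSum-cong) ⟩
      powerSum e m′ - properMultiplesSum e m′   ≈⟨ ramanujanSum≈ m′ ⟨
      ramanujanSum e m′                         ∎
      where
        ramanujanSum≈ : ∀ m → ramanujanSum e m ≈ powerSum e m - properMultiplesSum e m
        ramanujanSum≈ m = x≈z//y _ _ _
          (trans (sym (multiplesSum≈ramanujanSum+properMultiplesSum e∣r m)) (multiplesSum≈powerSum e∣r m))
        powerSum-cong : powerSum e m ≈ powerSum e m′
        powerSum-cong = trans (powerSum≈ e∣r m) (trans
          (reflexive (≡.cong (λ g → if ⌊ M ℕ.^ s ∣? g ⌋ then natK (M ℕ.^ s) else 0#) Gm≡Gm′))
          (sym (powerSum≈ e∣r m′)))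
          where open Cofactor e∣r using (M)
        termwise : ∀ e′ → 0 ℕ.< e′ → e′ ℕ.≤ r →
                   (if e′ ≡ᵇ e then 0# else multiplesTerm e m e′) ≈
                   (if e′ ≡ᵇ e then 0# else multiplesTerm e m′ e′)
        termwise e′ 0<e′ e′≤r with e′ ≡ᵇ e in e′≡ᵇe | e′ ∣? r | e ∣? e′
        ... | true  | _        | _       = refl
        ... | false | no  _    | _       = refl
        ... | false | yes _    | no  _   = refl
        ... | false | yes e′∣r | yes e∣e′ =
          ramanujanSum-classFunction′ fuel r∸e′<fuel e′∣r 0<m 0<m′ Gm≡Gm′
          where
            e<e′ : e ℕ.< e′
            e<e′ = ℕ.≤∧≢⇒< (∣⇒≤ {{ℕ.>-nonZero 0<e′}} e∣e′)
                     λ e≡e′ → ≡.subst T e′≡ᵇe (ℕ.≡⇒≡ᵇ e′ e (≡.sym e≡e′))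
            r∸e′<fuel : r ℕ.∸ e′ ℕ.< fuel
            r∸e′<fuel = ℕ.<-≤-trans (ℕ.∸-monoʳ-< e<e′ e′≤r) (ℕ.s≤s⁻¹ r∸e<1+fuel)
        properMultiplesSum-cong : properMultiplesSum e m ≈ properMultiplesSum e m′
        properMultiplesSum-cong = sum1-cong r termwise

    ramanujanSum-classFunction : ∀ {e} → e ∣ r → ClassFunction (ramanujanSum e)
    ramanujanSum-classFunction {e} = ramanujanSum-classFunction′ (suc r) (ℕ.s≤s (ℕ.m∸n≤m r e))

    fourier : (ℕ → Carrier) → ℕ → Carrier
    fourier h m = sum1 N (λ k → h k * ω ^ (k ℕ.* m))

    fourier-classFunction : ∀ {h} → ClassFunction h → ClassFunction (fourier h)
    fourier-classFunction {h} h-class {m} {m′} 0<m 0<m′ Gm≡Gm′ = begin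
      fourier h m
        ≈⟨ sum1-by-classes h-class _ ⟩
      sum1 r (λ e → if ⌊ e ∣? r ⌋ then h (e ℕ.^ s) * ramanujanSum e m else 0#)
        ≈⟨ sum1-cong r (λ e _ _ → termwise e) ⟩
      sum1 r (λ e → if ⌊ e ∣? r ⌋ then h (e ℕ.^ s) * ramanujanSum e m′ else 0#)
        ≈⟨ sum1-by-classes h-class _ ⟨
      fourier h m′ ∎
      where
        termwise : ∀ e → (if ⌊ e ∣? r ⌋ then h (e ℕ.^ s) * ramanujanSum e m else 0#) ≈
                         (if ⌊ e ∣? r ⌋ then h (e ℕ.^ s) * ramanujanSum e m′ else 0#)
        termwise e with e ∣? r
        ... | yes e∣r = *-congˡ (ramanujanSum-classFunction e∣r 0<m 0<m′ Gm≡Gm′)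
        ... | no  _   = refl


    ramanujan≈ramanujanSum : ∀ {e} → e ∣ r → ∀ m → ramanujan ω s (r / suc (e ℕ.∸ 1)) e m ≈ ramanujanSum e m
    ramanujan≈ramanujanSum {e} e∣r m = begin
      ramanujan ω s (r / suc (e ℕ.∸ 1)) e m
        ≡⟨ ≡.cong (λ d → ramanujan ω s d e m) r/[1+[e∸1]]≡M ⟩
      sum1 (M ℕ.^ s) _
        ≈⟨ sum1-cong (M ℕ.^ s) (λ j _ _ → φ[j*e^s]≈ j) ⟨
      sum1 (M ℕ.^ s) (λ j → φ (j ℕ.* e ℕ.^ s))
        ≈⟨ sum1-multiples (e ℕ.^ s) (M ℕ.^ s) φ φ≈0 ⟨
      sum1 (M ℕ.^ s ℕ.* e ℕ.^ s) φ
        ≡⟨ ≡.cong (λ n → sum1 n φ) (≡.trans (ℕ.*-comm (M ℕ.^ s) _) (≡.sym N≡e^s*M^s)) ⟩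
      ramanujanSum e m ∎
      where
        open Cofactor e∣r
        r/[1+[e∸1]]≡M : r / suc (e ℕ.∸ 1) ≡ M
        r/[1+[e∸1]]≡M = ≡.trans (/-congʳ (ℕ.m+[n∸m]≡n (ℕ.>-nonZero⁻¹ e))) (n/m≡quotient e∣r)
        φ : ℕ → Carrier
        φ k = if inClass e k then ω ^ (k ℕ.* m) else 0#
        φ≈0 : ∀ k → ¬ e ℕ.^ s ∣ k → φ k ≈ 0#
        φ≈0 k e^s∤k = if-¬T λ k∈class → e^s∤k (≡.subst (_∣ k) (inClass⇒G≡ k∈class) (G∣ k))
        φ[j*e^s]≈ : ∀ j → φ (j ℕ.* e ℕ.^ s) ≈
                          (if gcdPow s j (M ℕ.^ s) ≡ᵇ 1 then ω ^ (m ℕ.* j ℕ.* e ℕ.^ s) else 0#)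
        φ[j*e^s]≈ j = reflexive (≡.cong₂ (λ b x → if b then ω ^ x else 0#) inClass≡ exponent≡)
          where
            open +-*-Solver using (solve; _:*_; _:=_)
            G≡ : G (j ℕ.* e ℕ.^ s) ≡ G (e ℕ.^ s ℕ.* j)
            G≡ = ≡.cong G (ℕ.*-comm j (e ℕ.^ s))
            open Equivalence (G[e^s*j]≡e^s⇔gcdPow[j,M^s]≡1 j)
            inClass≡ : inClass e (j ℕ.* e ℕ.^ s) ≡ (gcdPow s j (M ℕ.^ s) ≡ᵇ 1)
            inClass≡ = T-injective
              (λ t → ℕ.≡⇒≡ᵇ _ 1 (to (≡.trans (≡.sym G≡) (inClass⇒G≡ t))))
              (λ t → ℕ.≡⇒≡ᵇ _ _ (≡.trans G≡ (from (ℕ.≡ᵇ⇒≡ _ 1 t))))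
            exponent≡ : j ℕ.* e ℕ.^ s ℕ.* m ≡ m ℕ.* j ℕ.* e ℕ.^ s
            exponent≡ = solve 3 (λ j E m → j :* E :* m := m :* j :* E) ≡.refl j (e ℕ.^ s) m

-- rep lives in Setup K although it does not involve K.
module Representatives {c ℓ} (K : CommutativeRing c ℓ) (N : ℕ) .{{_ : NonZero N}} where

  open import Data.Nat.Base
  open import Data.Nat.Properties
  open import Data.Nat.DivMod using (m%n<n; n%n≡0; m<n⇒m%n≡m; [m+n]%n≡m%n; %-distribˡ-+)
  open import Data.Nat.Divisibility using (∣⇒≤; m%n≡0⇒n∣m)
  open import Relation.Nullary using (contradiction)
  open import Data.Product using (_×_; _,_)
  open import Data.Sum using (inj₁; inj₂)
  open import Relation.Binary.PropositionalEquality
  open Setup K using (rep)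

  rep-mod : ∀ x → rep N x % N ≡ x % N
  rep-mod x with x % N in x%N≡
  ... | zero  = n%n≡0 N
  ... | suc t = m<n⇒m%n≡m (subst (_< N) x%N≡ (m%n<n x N))

  rep-cong : ∀ {x y} → x % N ≡ y % N → rep N x ≡ rep N y
  rep-cong {x} {y} x≡y with x % N | y % N | x≡y
  ... | _ | _ | refl = refl

  rep-+N : ∀ x → rep N (x + N) ≡ rep N x
  rep-+N x = rep-cong ([m+n]%n≡m%n x N)

  rep-range : ∀ x → 0 < rep N x × rep N x ≤ N
  rep-range x with x % N in x%N≡
  ... | zero  = >-nonZero⁻¹ N , ≤-refl
  ... | suc t = z<s , <⇒≤ (subst (_< N) x%N≡ (m%n<n x N))

  rep-id : ∀ {j} → 0 < j → j ≤ N → rep N j ≡ j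
  rep-id {j} 0<j j≤N with j % N in j%N≡
  ... | zero  = ≤-antisym (∣⇒≤ {{>-nonZero 0<j}} (m%n≡0⇒n∣m j N j%N≡)) j≤N
  ... | suc t with m≤n⇒m<n∨m≡n j≤N
  ...   | inj₁ j<N  = trans (sym j%N≡) (m<n⇒m%n≡m j<N)
  ...   | inj₂ refl = contradiction (trans (sym j%N≡) (n%n≡0 N)) λ ()

  rep-∸ : ∀ {x y k} → x % N ≡ y % N → k ≤ N → rep N ((x + N) ∸ k) ≡ rep N ((y + N) ∸ k)
  rep-∸ {x} {y} {k} x≡y k≤N = rep-cong (begin
    ((x + N) ∸ k) % N                ≡⟨ cong (_% N) (+-∸-assoc x k≤N) ⟩
    (x + (N ∸ k)) % N                ≡⟨ %-distribˡ-+ x (N ∸ k) N ⟩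
    (x % N + (N ∸ k) % N) % N        ≡⟨ cong (λ z → (z + (N ∸ k) % N) % N) x≡y ⟩
    (y % N + (N ∸ k) % N) % N        ≡⟨ %-distribˡ-+ y (N ∸ k) N ⟨
    (y + (N ∸ k)) % N                ≡⟨ cong (_% N) (+-∸-assoc y k≤N) ⟨
    ((y + N) ∸ k) % N                ∎)
    where open ≡-Reasoning

module Convolution {c ℓ} (K : CommutativeRing c ℓ) (s : ℕ) .{{_ : NonZero s}} (r : ℕ) .{{_ : NonZero r}} where

  open import Data.Nat.Base as ℕ using (suc)
  import Data.Nat.Properties as ℕ
  open import Data.Nat.Divisibility using (_∣_; _∣?_; n∣m*n; m∣m*n)
  open import Data.Nat.DivMod using (_/_)
  open import Data.Bool using (if_then_else_)
  open import Relation.Nullary.Decidable using (⌊_⌋)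
  open import Data.Nat.Solver using (module +-*-Solver)
  open import Data.Product using (_×_; _,_; proj₁)
  open import Function.Base using (_∘_)
  open import Relation.Binary.PropositionalEquality as ≡ using (_≡_; _≢_)
  open import Relation.Nullary using (¬_; yes; no)
  open CommutativeRing K
  open Setup K
  open import Algebra.Definitions.RawSemiring (Semiring.rawSemiring semiring) using (_^_)
  open import Algebra.Properties.Semiring.Exp semiring using (^-homo-*; ^-assocʳ)
  open Sums K
  open RootsOfUnity K
  open Classes s r
  open ClassSums K s r
  open Representatives K N using (rep-mod; rep-∸)
  open import Relation.Binary.Reasoning.Setoid setoid

  G-rep : ∀ x → G (rep N x) ≡ G x
  G-rep x = ≡.trans (G-mod (rep N x)) (≡.trans (≡.cong G (rep-mod x)) (≡.sym (G-mod x)))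

  conv-rep : ∀ f g n → conv N f g n ≈ conv N f g (rep N n)
  conv-rep f g n = sum1-cong N λ k _ k≤N → *-congˡ (reflexive (≡.cong g (rep-∸ (≡.sym (rep-mod n)) k≤N)))

  module _ (noZeroDivisors : NoZeroDivisors) {ζ : Carrier} (ζ^N≈1 : ζ ^ N ≈ 1#)
           (ζ^k≉1 : ∀ k → 0 ℕ.< k → k ℕ.< N → ¬ ζ ^ k ≈ 1#) where

    open Primitive N ζ^N≈1 ζ^k≉1

    P : ℕ
    P = N ℕ.∸ 1

    1+P≡N : suc P ≡ N
    1+P≡N = ℕ.m+[n∸m]≡n (ℕ.>-nonZero⁻¹ N)

    N∣k+P*k : ∀ k → N ∣ k ℕ.+ P ℕ.* k
    N∣k+P*k k = ≡.subst (_∣ k ℕ.+ P ℕ.* k) 1+P≡N (m∣m*n k)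

    ζ⁻¹ : Carrier
    ζ⁻¹ = ζ ^ P

    ζ⁻¹^N≈1 : ζ⁻¹ ^ N ≈ 1#
    ζ⁻¹^N≈1 = trans (^-assocʳ ζ P N) (^-multiple (n∣m*n P))

    ζ⁻¹^k≉1 : ∀ k → 0 ℕ.< k → k ℕ.< N → ¬ ζ⁻¹ ^ k ≈ 1#
    ζ⁻¹^k≉1 k 0<k k<N ζ⁻¹^k≈1 = ζ^k≉1 k 0<k k<N (begin
      ζ ^ k                  ≈⟨ *-identityʳ _ ⟨
      ζ ^ k * 1#             ≈⟨ *-congˡ ζ⁻¹^k≈1 ⟨
      ζ ^ k * ζ⁻¹ ^ k        ≈⟨ *-congˡ (^-assocʳ ζ P k) ⟩
      ζ ^ k * ζ ^ (P ℕ.* k)  ≈⟨ ^-homo-* ζ k (P ℕ.* k) ⟨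
      ζ ^ (k ℕ.+ P ℕ.* k)    ≈⟨ ^-multiple (N∣k+P*k k) ⟩
      1#                     ∎)

    module Fζ   = RamanujanSums.PrimitiveRoot K s r noZeroDivisors ζ^N≈1 ζ^k≉1
    module Fζ⁻¹ = RamanujanSums.PrimitiveRoot K s r noZeroDivisors ζ⁻¹^N≈1 ζ⁻¹^k≉1
    open Fζ using (fourier)

    ζ^km*ζ⁻¹^mn : ∀ k m n → ζ ^ (k ℕ.* m) * ζ⁻¹ ^ (m ℕ.* n) ≈ (ζ ^ (k ℕ.+ P ℕ.* n)) ^ m
    ζ^km*ζ⁻¹^mn k m n = begin
      ζ ^ (k ℕ.* m) * ζ⁻¹ ^ (m ℕ.* n)         ≈⟨ *-congˡ (^-assocʳ ζ P (m ℕ.* n)) ⟩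
      ζ ^ (k ℕ.* m) * ζ ^ (P ℕ.* (m ℕ.* n))   ≈⟨ ^-homo-* ζ (k ℕ.* m) _ ⟨
      ζ ^ (k ℕ.* m ℕ.+ P ℕ.* (m ℕ.* n))       ≡⟨ ≡.cong (ζ ^_) exponent≡ ⟩
      ζ ^ ((k ℕ.+ P ℕ.* n) ℕ.* m)             ≈⟨ ^-assocʳ ζ (k ℕ.+ P ℕ.* n) m ⟨
      (ζ ^ (k ℕ.+ P ℕ.* n)) ^ m               ∎
      where
        open +-*-Solver
        exponent≡ : k ℕ.* m ℕ.+ P ℕ.* (m ℕ.* n) ≡ (k ℕ.+ P ℕ.* n) ℕ.* m
        exponent≡ = solve 4 (λ k m P n → k :* m :+ P :* (m :* n) := (k :+ P :* n) :* m) ≡.refl k m P n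

    orthogonality-≢ : ∀ {k n} → 0 ℕ.< k → k ℕ.≤ N → 0 ℕ.< n → n ℕ.≤ N → k ≢ n →
                      geometric (ζ ^ (k ℕ.+ P ℕ.* n)) N ≈ 0#
    orthogonality-≢ {k} {n} 0<k k≤N 0<n n≤N k≢n = geometric-0 noZeroDivisors N
      (trans (^-assocʳ ζ (k ℕ.+ P ℕ.* n) N) (^-multiple (n∣m*n (k ℕ.+ P ℕ.* n))))
      λ ζ^[k+Pn]≈1 → k≢n (∣-+-range⇒≡ 0<k k≤N 0<n n≤N (^≈1⇒∣ ζ^[k+Pn]≈1) (N∣k+P*k n))
      where open Arithmetic using (∣-+-range⇒≡)

    orthogonality-≡ : ∀ n → geometric (ζ ^ (n ℕ.+ P ℕ.* n)) N ≈ natK N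
    orthogonality-≡ n = geometric-1 N (^-multiple (N∣k+P*k n))

    fourier-inversion : ∀ h {n} → 0 ℕ.< n → n ℕ.≤ N → Fζ⁻¹.fourier (fourier h) n ≈ natK N * h n
    fourier-inversion h {n} 0<n n≤N = begin
      Fζ⁻¹.fourier (fourier h) n
        ≈⟨ sum1-cong N (λ m _ _ → trans (*-distribʳ-sum1 N _ _) (sum1-cong N λ k _ _ → *-assoc _ _ _)) ⟩
      sum1 N (λ m → sum1 N (λ k → h k * (ζ ^ (k ℕ.* m) * ζ⁻¹ ^ (m ℕ.* n))))
        ≈⟨ sum1-swap N N _ ⟩
      sum1 N (λ k → sum1 N (λ m → h k * (ζ ^ (k ℕ.* m) * ζ⁻¹ ^ (m ℕ.* n))))
        ≈⟨ sum1-cong N (λ k _ _ → trans (sym (*-distribˡ-sum1 N (h k) _))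
                                        (*-congˡ (sum1-cong N λ m _ _ → ζ^km*ζ⁻¹^mn k m n))) ⟩
      sum1 N (λ k → h k * geometric (ζ ^ (k ℕ.+ P ℕ.* n)) N)
        ≈⟨ sum1-single N _ 0<n n≤N (λ k 0<k k≤N k≢n →
             trans (*-congˡ (orthogonality-≢ 0<k k≤N 0<n n≤N k≢n)) (zeroʳ _)) ⟩
      h n * geometric (ζ ^ (n ℕ.+ P ℕ.* n)) N
        ≈⟨ *-congˡ (orthogonality-≡ n) ⟩
      h n * natK N
        ≈⟨ *-comm _ _ ⟩
      natK N * h n ∎

    fourier-shift : ∀ g m {k} → 0 ℕ.< k → k ℕ.≤ N →
      sum1 N (λ n → g (rep N ((n ℕ.+ N) ℕ.∸ k)) * ζ ^ (n ℕ.* m)) ≈ ζ ^ (k ℕ.* m) * fourier g m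
    fourier-shift g m {k} 0<k k≤N = begin
      sum1 N (λ n → g (rep N ((n ℕ.+ N) ℕ.∸ k)) * ζ ^ (n ℕ.* m))
        ≈⟨ sum1-cong N (λ n _ _ → unshift n) ⟩
      sum1 N (λ n → φ (n ℕ.+ (N ℕ.∸ k)))
        ≈⟨ sum1-shift-periodic N (N ℕ.∸ k) φ φ-periodic ⟩
      sum1 N φ
        ≈⟨ sum1-cong N (λ j 0<j j≤N → φ≈ 0<j j≤N) ⟩
      sum1 N (λ j → ζ ^ (k ℕ.* m) * (g j * ζ ^ (j ℕ.* m)))
        ≈⟨ *-distribˡ-sum1 N _ _ ⟨
      ζ ^ (k ℕ.* m) * fourier g m ∎
      where
        open Representatives K N using (rep-+N; rep-id)
        open +-*-Solver
        φ : ℕ → Carrier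
        φ x = g (rep N x) * ζ ^ ((x ℕ.+ k) ℕ.* m)
        φ-periodic : ∀ x → φ (x ℕ.+ N) ≈ φ x
        φ-periodic x = *-cong (reflexive (≡.cong g (rep-+N x)))
          (trans (reflexive (≡.cong (ζ ^_) exponent≡)) (^-+-multiple ((x ℕ.+ k) ℕ.* m) (m∣m*n m)))
          where
            exponent≡ : (x ℕ.+ N ℕ.+ k) ℕ.* m ≡ (x ℕ.+ k) ℕ.* m ℕ.+ N ℕ.* m
            exponent≡ = solve 4 (λ x N k m → (x :+ N :+ k) :* m := (x :+ k) :* m :+ N :* m) ≡.refl x N k m
        unshift : ∀ n → g (rep N ((n ℕ.+ N) ℕ.∸ k)) * ζ ^ (n ℕ.* m) ≈ φ (n ℕ.+ (N ℕ.∸ k))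
        unshift n = *-cong (reflexive (≡.cong (g ∘ rep N) (ℕ.+-∸-assoc n k≤N)))
          (sym (trans (reflexive (≡.cong (ζ ^_) exponent≡)) (^-+-multiple (n ℕ.* m) (m∣m*n m))))
          where
            exponent≡ : (n ℕ.+ (N ℕ.∸ k) ℕ.+ k) ℕ.* m ≡ n ℕ.* m ℕ.+ N ℕ.* m
            exponent≡ = ≡.trans (≡.cong (λ x → (x ℕ.+ k) ℕ.* m) (≡.sym (ℕ.+-∸-assoc n k≤N)))
              (≡.trans (≡.cong (ℕ._* m) (ℕ.m∸n+n≡m (ℕ.≤-trans k≤N (ℕ.m≤n+m N n)))) (ℕ.*-distribʳ-+ m n N))
        φ≈ : ∀ {j} → 0 ℕ.< j → j ℕ.≤ N → φ j ≈ ζ ^ (k ℕ.* m) * (g j * ζ ^ (j ℕ.* m))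
        φ≈ {j} 0<j j≤N = begin
          g (rep N j) * ζ ^ ((j ℕ.+ k) ℕ.* m)     ≈⟨ *-cong (reflexive (≡.cong g (rep-id 0<j j≤N)))
                                                        (trans (reflexive (≡.cong (ζ ^_) (ℕ.*-distribʳ-+ m j k)))
                                                               (^-homo-* ζ (j ℕ.* m) (k ℕ.* m))) ⟩
          g j * (ζ ^ (j ℕ.* m) * ζ ^ (k ℕ.* m))   ≈⟨ x∙yz≈z∙xy _ _ _ ⟩
          ζ ^ (k ℕ.* m) * (g j * ζ ^ (j ℕ.* m))   ∎
          where open import Algebra.Properties.CommutativeSemigroup *-commutativeSemigroup using (x∙yz≈z∙xy)

    fourier-conv : ∀ f g m → fourier (conv N f g) m ≈ fourier f m * fourier g m
    fourier-conv f g m = begin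
      fourier (conv N f g) m
        ≈⟨ sum1-cong N (λ n _ _ → trans (*-distribʳ-sum1 N _ _) (sum1-cong N λ k _ _ → *-assoc _ _ _)) ⟩
      sum1 N (λ n → sum1 N (λ k → f k * (g (rep N ((n ℕ.+ N) ℕ.∸ k)) * ζ ^ (n ℕ.* m))))
        ≈⟨ sum1-swap N N _ ⟩
      sum1 N (λ k → sum1 N (λ n → f k * (g (rep N ((n ℕ.+ N) ℕ.∸ k)) * ζ ^ (n ℕ.* m))))
        ≈⟨ sum1-cong N (λ k 0<k k≤N → trans (sym (*-distribˡ-sum1 N (f k) _))
                                           (trans (*-congˡ (fourier-shift g m 0<k k≤N)) (sym (*-assoc _ _ _)))) ⟩
      sum1 N (λ k → f k * ζ ^ (k ℕ.* m) * fourier g m)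
        ≈⟨ *-distribʳ-sum1 N _ _ ⟨
      fourier f m * fourier g m ∎

    module _ {invN : Carrier} (N*invN≈1 : natK N * invN ≈ 1#) where

      invN*N* : ∀ x → invN * (natK N * x) ≈ x
      invN*N* x = begin
        invN * (natK N * x)   ≈⟨ *-assoc _ _ _ ⟨
        invN * natK N * x     ≈⟨ *-congʳ (trans (*-comm _ _) N*invN≈1) ⟩
        1# * x                ≈⟨ *-identityˡ x ⟩
        x                     ∎

      N*[invN*x*[invN*y]] : ∀ x y → natK N * (invN * x * (invN * y)) ≈ invN * (x * y)
      N*[invN*x*[invN*y]] x y = begin
        natK N * (invN * x * (invN * y))    ≈⟨ *-congˡ (*-assoc invN x _) ⟩
        natK N * (invN * (x * (invN * y)))  ≈⟨ *-assoc _ _ _ ⟨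
        natK N * invN * (x * (invN * y))    ≈⟨ *-congʳ N*invN≈1 ⟩
        1# * (x * (invN * y))               ≈⟨ *-identityˡ _ ⟩
        x * (invN * y)                      ≈⟨ x∙yz≈y∙xz x invN y ⟩
        invN * (x * y)                      ∎
        where open import Algebra.Properties.CommutativeSemigroup *-commutativeSemigroup using (x∙yz≈y∙xz)

      conv-classFunction : ∀ {f g} → ClassFunction f → ClassFunction g → ClassFunction (conv N f g)
      conv-classFunction {f} {g} f-class g-class {m} {m′} 0<m 0<m′ Gm≡Gm′ = begin
        C m                      ≈⟨ conv-rep f g m ⟩
        C (rep N m)              ≈⟨ recover (rep-range m) ⟩
        invN * I (rep N m)       ≈⟨ *-congˡ (I-class (proj₁ (rep-range m)) (proj₁ (rep-range m′))
                                      (≡.trans (G-rep m) (≡.trans Gm≡Gm′ (≡.sym (G-rep m′))))) ⟩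
        invN * I (rep N m′)      ≈⟨ recover (rep-range m′) ⟨
        C (rep N m′)             ≈⟨ conv-rep f g m′ ⟨
        C m′                     ∎
        where
          open Representatives K N using (rep-range)
          C = conv N f g
          I = Fζ⁻¹.fourier (fourier C)
          Ĉ-class : ClassFunction (fourier C)
          Ĉ-class 0<n 0<n′ Gn≡Gn′ = trans (fourier-conv f g _) (trans
            (*-cong (Fζ.fourier-classFunction f-class 0<n 0<n′ Gn≡Gn′)
                    (Fζ.fourier-classFunction g-class 0<n 0<n′ Gn≡Gn′))
            (sym (fourier-conv f g _)))
          I-class : ClassFunction I
          I-class = Fζ⁻¹.fourier-classFunction Ĉ-class
          recover : ∀ {n} → 0 ℕ.< n × n ℕ.≤ N → C n ≈ invN * I n
          recover (0<n , n≤N) = trans (sym (invN*N* _)) (*-congˡ (sym (fourier-inversion C 0<n n≤N)))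

      alpha≈ : ∀ {h} → ClassFunction h → ∀ d .{{_ : NonZero d}} →
               alpha ζ invN r s h d ≈ invN * fourier h ((r / d) ℕ.^ s)
      alpha≈ {h} h-class d = *-congˡ (begin
        sum1 r (λ e → if ⌊ e ∣? r ⌋ then h (e ℕ.^ s) * ramanujan ζ s (r / suc (e ℕ.∸ 1)) e m else 0#)
          ≈⟨ sum1-cong r (λ e _ _ → termwise e) ⟩
        sum1 r (λ e → if ⌊ e ∣? r ⌋ then h (e ℕ.^ s) * Fζ.ramanujanSum e m else 0#)
          ≈⟨ sum1-by-classes h-class _ ⟨
        fourier h m ∎)
        where
          m = (r / d) ℕ.^ s
          termwise : ∀ e → (if ⌊ e ∣? r ⌋ then h (e ℕ.^ s) * ramanujan ζ s (r / suc (e ℕ.∸ 1)) e m else 0#) ≈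
                           (if ⌊ e ∣? r ⌋ then h (e ℕ.^ s) * Fζ.ramanujanSum e m else 0#)
          termwise e with e ∣? r
          ... | yes e∣r = *-congˡ (Fζ.ramanujan≈ramanujanSum e∣r m)
          ... | no  _   = refl

      conv-isEven : ∀ {f g} → IsEven r s f → IsEven r s g → IsEven r s (conv N f g)
      conv-isEven f-even g-even =
        classFunction⇒isEven (conv-classFunction (isEven⇒classFunction f-even) (isEven⇒classFunction g-even))

      alpha-conv : ∀ {f g} → IsEven r s f → IsEven r s g → ∀ d .{{_ : NonZero d}} →
                   alpha ζ invN r s (conv N f g) d ≈ natK N * (alpha ζ invN r s f d * alpha ζ invN r s g d)
      alpha-conv {f} {g} f-even g-even d = begin
        alpha ζ invN r s (conv N f g) d      ≈⟨ alpha≈ (conv-classFunction f-class g-class) d ⟩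
        invN * fourier (conv N f g) m        ≈⟨ *-congˡ (fourier-conv f g m) ⟩
        invN * (f̂ * ĝ)                      ≈⟨ N*[invN*x*[invN*y]] f̂ ĝ ⟨
        natK N * (invN * f̂ * (invN * ĝ))     ≈⟨ *-congˡ (*-cong (alpha≈ f-class d) (alpha≈ g-class d)) ⟨
        natK N * (alpha ζ invN r s f d * alpha ζ invN r s g d) ∎
        where
          f-class = isEven⇒classFunction f-even
          g-class = isEven⇒classFunction g-even
          m = (r / d) ℕ.^ s
          f̂ = fourier f m
          ĝ = fourier g m

open import Level using (Level)
open import Data.Nat as ℕ using (ℕ; NonZero; _<_; _≤_)
open import Data.Nat.Properties using (m^n≢0)
open import Data.Nat.Divisibility using (_∣_)
open import Data.Product using (_×_; _,_)
open import Data.Sum using (_⊎_)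
open import Relation.Nullary using (¬_)
open CommutativeRing using (Carrier; _≈_; _*_; 0#; 1#)
open Setup using (ArithFun; IsEven; conv; alpha; pow; natK)

mainTheorem2 : {c ℓ : Level} (K : CommutativeRing c ℓ) →
    ¬ (_≈_ K (1# K) (0# K)) →
    (∀ x y → _≈_ K (_*_ K x y) (0# K) → (_≈_ K x (0# K)) ⊎ (_≈_ K y (0# K))) →
    (r s : ℕ) .{{_ : NonZero r}} .{{_ : NonZero s}} →
    (ζ : Carrier K) → _≈_ K (pow K ζ (r ℕ.^ s)) (1# K) →
    (∀ k → 1 ≤ k → k < r ℕ.^ s → ¬ (_≈_ K (pow K ζ k) (1# K))) →
    (invN : Carrier K) → _≈_ K (_*_ K (natK K (r ℕ.^ s)) invN) (1# K) →
    (f g : ArithFun K) → IsEven K r s f → IsEven K r s g →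
    IsEven K r s (conv K (r ℕ.^ s) {{m^n≢0 r s}} f g)
    × (∀ (d : ℕ) .{{_ : NonZero d}} → d ∣ r →
         _≈_ K (alpha K ζ invN r s (conv K (r ℕ.^ s) {{m^n≢0 r s}} f g) d)
               (_*_ K (natK K (r ℕ.^ s)) (_*_ K (alpha K ζ invN r s f d) (alpha K ζ invN r s g d))))
mainTheorem2 K _ noZeroDivisors r s ζ ζ^N≈1 ζ^k≉1 invN N*invN≈1 f g f-even g-even =
    conv-isEven noZeroDivisors ζ^N≈1 ζ^k≉1 N*invN≈1 f-even g-even
  , λ d _ → alpha-conv noZeroDivisors ζ^N≈1 ζ^k≉1 N*invN≈1 f-even g-even d
  where open Convolution K s r
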